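{- Let $\Sigma$ be a finite set. A subset $S\subseteq\Sigma^{\mathbb N}$ is a safety constraint if and only if there exists a prefix-free subset $P\subseteq\Sigma^+$ such that $S=\mathcal C_{\Omega}(P)$.
   Context: $\Sigma^{\mathbb N}$ is the set of streams $s:\mathbb N\to\Sigma$; $\Sigma^+$ the set of nonempty finite words, $|u|$ word length, $\mathbf 1=\{\Downarrow\}$, $+$ disjoint union. For a stream or word $s$: $s[m:]$ is the sequence $k\mapsto s(k+m)$, and $s[0:m]$ is the prefix $s(0)\cdots s(m-1)$. A set $S\subseteq\Sigma^{\mathbb N}$ is a safety constraint if for every $s\in\Sigma^{\mathbb N}$: if for every $m\in\mathbb N$ there is $s'\in S$ with $s'[0:m]=s[0:m]$, then $s\in S$. A set $P\subseteq\Sigma^+$ is prefix-free if $u\in P$ implies $u[0:m]\notin P$ for $0\le m<|u|$; $n^{ -1}\cdot P=\{u\mid nu\in P\}$. A $\Sigma$-detector is a map $a:A\to(\mathbf 1+A)^\Sigma$. $\Omega$ denotes the detector whose carrier is the set of all prefix-free subsets of $\Sigma^+$, with $\Omega(P)(n)=\Downarrow$ if $n\in P$ and $\Omega(P)(n)=n^{ -1}\cdot P$ otherwise. For a stream $s$, $[s]$ is the system with output with state set $\{s[k:]\mid k\in\mathbb N\}$, output $t\mapsto t(0)$ and transition $t\mapsto t[1:]$. For a system with output $\sigma:Q\to\Sigma\times Q$, $\sigma=\langle\mathrm{out}_\sigma,\mathrm{tr}_\sigma\rangle$, and a detector $a$ with carrier $A$, $\mathrm{Join}(\sigma,a):Q\times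 A\to\mathbf 1+(Q\times A)$ is given by $\mathrm{Join}(\sigma,a)(x,y)=\Downarrow$ if $a(y)(\mathrm{out}_\sigma x)=\Downarrow$, and $(\mathrm{tr}_\sigma x,a(y)(\mathrm{out}_\sigma x))$ otherwise. For a map $g:G\to\mathbf 1+G$, the iterates are $g^{(1)}=g$, and $g^{(k+1)}(x)=\Downarrow$ if $g^{(k)}(x)=\Downarrow$, else $g(g^{(k)}(x))$. For a detector $a$ and $x$ in its carrier, $\mathcal C_a(x)$ is the set of all $s\in\Sigma^{\mathbb N}$ such that $\mathrm{Join}([s],a)^{(k)}(s,x)\neq\Downarrow$ for all $k\ge1$ (equivalently, the anamorphism of $\mathrm{Join}([s],a)$ into the final system with termination on $\mathbb N\cup\{\infty\}$ sends $(s,x)$ to $\infty$). -}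

module Defs where

open import Level using (Level; 0ℓ; _⊔_)
open import Data.Nat using (ℕ; zero; suc; _+_; _<_; s≤s)
open import Data.Nat.Properties using (+-suc; +-identityʳ)
open import Data.Unit.Polymorphic using (⊤; tt)
open import Data.Sum using (_⊎_; inj₁; inj₂)
open import Data.Product using (Σ-syntax; ∃-syntax; _×_; _,_; proj₁; proj₂)
open import Data.List using (List; []; _∷_; take; length; map; upTo)
open import Data.List.NonEmpty using (List⁺; _∷_; _∷⁺_; head; tail)
open import Relation.Nullary using (¬_; yes; no)
open import Relation.Unary using (Pred)
open import Relation.Binary.PropositionalEquality using (_≡_; refl; sym; trans; cong)
open import Axiom.ExcludedMiddle using (ExcludedMiddle)

Stream : Set → Set
Stream Σ = ℕ → Σ

shift : ∀ {Σ : Set} → Stream Σ → ℕ → Stream Σ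
shift s m = λ k → s (k + m)

prefixS : ∀ {Σ : Set} → Stream Σ → ℕ → List Σ
prefixS s m = map s (upTo m)

IsSafety : ∀ {Σ : Set} → Pred (Stream Σ) 0ℓ → Set
IsSafety {Σ} S =
  (s : Stream Σ) →
  ((m : ℕ) → ∃[ s' ] (S s' × prefixS s' m ≡ prefixS s m)) →
  S s

-- Nonempty finite words Σ^+ are List⁺ Σ.
-- wprefix u m  is  u[0:m+1]  (the empty prefix u[0:0] is not in Σ^+).
wprefix : ∀ {Σ : Set} → List⁺ Σ → ℕ → List⁺ Σ
wprefix u m = head u ∷ take m (tail u)

-- Prefix-free: u ∈ P ⇒ u[0:m] ∉ P for 0 ≤ m < |u|  (m = 0 is vacuous)
PrefixFree : ∀ {Σ : Set} → Pred (List⁺ Σ) 0ℓ → Set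
PrefixFree {Σ} P =
  (u : List⁺ Σ) → P u → (m : ℕ) → m < length (tail u) → ¬ P (wprefix u m)

deriv : ∀ {Σ : Set} → Σ → Pred (List⁺ Σ) 0ℓ → Pred (List⁺ Σ) 0ℓ
deriv n P u = P (n ∷⁺ u)

deriv-pf : ∀ {Σ : Set} (n : Σ) (P : Pred (List⁺ Σ) 0ℓ) →
           PrefixFree P → PrefixFree (deriv n P)
deriv-pf n P pf u h m m< h' = pf (n ∷⁺ u) h (suc m) (s≤s m<) h'

𝟏+_ : ∀ {ℓ} → Set ℓ → Set ℓ
𝟏+_ {ℓ} A = ⊤ {ℓ} ⊎ A

⇓ : ∀ {ℓ} {A : Set ℓ} → 𝟏+ A
⇓ = inj₁ tt

Detector : ∀ {ℓ} → Set → Set ℓ → Set ℓ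
Detector Σ A = A → Σ → 𝟏+ A

System : ∀ {ℓ} → Set → Set ℓ → Set ℓ
System Σ Q = Q → Σ × Q

-- The system [s]: states {s[k:] | k ∈ ℕ}, a state being a stream t
-- together with some k such that t equals s[k:] (pointwise)
[_]-State : ∀ {Σ : Set} → Stream Σ → Set
[_]-State {Σ} s = Σ[ t ∈ Stream Σ ] ∃[ k ] ((i : ℕ) → t i ≡ shift s k i)

[_] : ∀ {Σ : Set} (s : Stream Σ) → System Σ [ s ]-State
[ s ] (t , k , p) =
  t 0 , (shift t 1 , suc k , λ i → trans (p (i + 1)) (cong s (lemma i k)))
  where
  lemma : ∀ i k → (i + 1) + k ≡ i + suc k
  lemma zero k = refl
  lemma (suc i) k = cong suc (lemma i k)

[_]-start : ∀ {Σ : Set} (s : Stream Σ) → [ s ]-State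
[ s ]-start = s , 0 , λ i → cong s (sym (+-identityʳ i))

Join : ∀ {ℓ ℓ'} {Σ : Set} {Q : Set ℓ} {A : Set ℓ'} →
       System Σ Q → Detector Σ A → Q × A → 𝟏+ (Q × A)
Join σ a (x , y) with a y (proj₁ (σ x))
... | inj₁ _  = ⇓
... | inj₂ y' = inj₂ (proj₂ (σ x) , y')

-- iter g k = g^(k+1)
iter : ∀ {ℓ} {G : Set ℓ} → (G → 𝟏+ G) → ℕ → G → 𝟏+ G
iter g zero x = g x
iter g (suc k) x with iter g k x
... | inj₁ _ = ⇓
... | inj₂ y = g y

𝒞 : ∀ {ℓ} {Σ : Set} {A : Set ℓ} → Detector Σ A → A → Pred (Stream Σ) ℓ
𝒞 a x s = (k : ℕ) → ¬ (iter (Join [ s ] a) k ([ s ]-start , x) ≡ ⇓)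

PFSet : Set → Set₁
PFSet Σ = Σ[ P ∈ Pred (List⁺ Σ) 0ℓ ] PrefixFree P

-- Ω(P)(n) = ⇓ if n ∈ P, n⁻¹·P otherwise.  Deciding "n ∈ P" for an
-- arbitrary subset requires excluded middle, supplied as argument.
Ω : ExcludedMiddle 0ℓ → (Σ : Set) → Detector Σ (PFSet Σ)
Ω lem Σ (P , pf) n with lem {P (n ∷ [])}
... | yes _ = ⇓
... | no _  = inj₂ (deriv n P , deriv-pf n P pf)

module Submission where

-- A stream is accepted by Ω from state P exactly when none of its
-- nonempty prefixes lies in P; the theorem then becomes a statement about
-- sets of the form  Avoids P = { s | no prefix of s is in P }.
--
--  * Running a detector along [s] is the same as feeding it the letters of
--    s one by one ('run'), so 𝒞_a(y) is the set of streams on which 'run'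
--    never halts (𝒞-run).  For Ω, 'run' halts at step j precisely when
--    some prefix s[0:j+1] is in P (𝒞Ω≐Avoids).
--  * Every Avoids P is a safety constraint, for an arbitrary P: a stream
--    whose prefixes all occur in Avoids P has no prefix in P.
--  * Conversely a safety constraint S equals Avoids of its minimal bad
--    prefixes (words extending to no member of S all of whose proper
--    prefixes do), a prefix-free set.  Showing that a stream avoiding them
--    has only good prefixes is a strong induction on the prefix length
--    that uses excluded middle.

open import Defs
open import Level using (0ℓ)
open import Data.Nat using (ℕ; zero; suc; _<_; _≤_; s≤s)
open import Data.Nat.Properties using (+-comm; <⇒≤)
open import Data.Nat.Induction using (<-rec)
open import Data.Fin using (Fin)
open import Data.Product using (∃-syntax; _×_; _,_; proj₁; proj₂)
open import Data.Sum using (inj₁; inj₂)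
open import Data.List using ([]; _∷_; map; applyUpTo; upTo; length)
open import Data.List.Properties using (map-cong; map-∘; map-upTo; ∷-injectiveˡ; ∷-injectiveʳ)
open import Data.List.NonEmpty using (List⁺; _∷_; _∷⁺_; head; tail; toList)
open import Data.Empty using (⊥-elim)
open import Relation.Nullary using (¬_; yes; no)
open import Relation.Unary using (Pred; _≐_)
open import Relation.Unary.Properties using (≐-trans; ≐-sym)
open import Relation.Binary.PropositionalEquality
  using (_≡_; _≢_; refl; sym; trans; cong; cong₂; subst; module ≡-Reasoning)
open import Function.Base using (_∘_)
open import Function.Bundles using (_↔_; _⇔_; mk⇔; Equivalence)
open import Axiom.ExcludedMiddle using (ExcludedMiddle)

open Equivalence using (to; from)

_>>=⇓_ : ∀ {ℓ ℓ'} {X : Set ℓ} {Y : Set ℓ'} → 𝟏+ X → (X → 𝟏+ Y) → 𝟏+ Y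
inj₁ _ >>=⇓ f = ⇓
inj₂ x >>=⇓ f = f x

iter-suc : ∀ {ℓ} {G : Set ℓ} (g : G → 𝟏+ G) (k : ℕ) (x : G) →
           iter g (suc k) x ≡ (g x >>=⇓ iter g k)
iter-suc g zero x with g x
... | inj₁ _ = refl
... | inj₂ _ = refl
iter-suc g (suc k) x rewrite iter-suc g k x with g x
... | inj₁ _ = refl
... | inj₂ _ = refl

run : ∀ {ℓ} {A : Set} {B : Set ℓ} → Detector A B → Stream A → B → ℕ → 𝟏+ B
run a t y zero    = a y (t 0)
run a t y (suc k) = a y (t 0) >>=⇓ λ y' → run a (shift t 1) y' k

-- Join([s], a) halts after k+1 steps from a state (t, y) of [s] × A iff
-- the detector halts within k+1 letters of t: the system [s] only
-- supplies the letters of t in order.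
Join-halts⇔run-halts :
  ∀ {ℓ} {A : Set} {B : Set ℓ} (a : Detector A B) (s : Stream A)
  (k : ℕ) (q : [ s ]-State) (y : B) →
  (iter (Join [ s ] a) k (q , y) ≡ ⇓) ⇔ (run a (proj₁ q) y k ≡ ⇓)
Join-halts⇔run-halts a s zero (t , _) y with a y (t 0)
... | inj₁ _ = mk⇔ (λ _ → refl) (λ _ → refl)
... | inj₂ _ = mk⇔ (λ ()) (λ ())
Join-halts⇔run-halts a s (suc k) q@(t , _) y
  rewrite iter-suc (Join [ s ] a) k (q , y) with a y (t 0)
... | inj₁ _  = mk⇔ (λ _ → refl) (λ _ → refl)
... | inj₂ y' = Join-halts⇔run-halts a s k _ y'

𝒞-run : ∀ {ℓ} {A : Set} {B : Set ℓ} (a : Detector A B) (y : B) (s : Stream A) →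
        𝒞 a y s ⇔ (∀ k → run a s y k ≢ ⇓)
𝒞-run a y s = mk⇔
  (λ c k halt → c k (from (Join-halts⇔run-halts a s k [ s ]-start y) halt))
  (λ r k halt → r k (to (Join-halts⇔run-halts a s k [ s ]-start y) halt))

-- pre t j = t[0:j+1] as a nonempty word.
pre : ∀ {A : Set} → Stream A → ℕ → List⁺ A
pre t zero    = t 0 ∷ []
pre t (suc j) = t 0 ∷⁺ pre (shift t 1) j

pre-length : ∀ {A : Set} (t : Stream A) (j : ℕ) → length (tail (pre t j)) ≡ j
pre-length t zero    = refl
pre-length t (suc j) = cong suc (pre-length (shift t 1) j)

pre-head : ∀ {A : Set} (t : Stream A) (j : ℕ) → head (pre t j) ≡ t 0
pre-head t zero    = refl
pre-head t (suc j) = refl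

wprefix-pre : ∀ {A : Set} (t : Stream A) {j m : ℕ} → m ≤ j → wprefix (pre t j) m ≡ pre t m
wprefix-pre t {j} {zero} _ = cong (_∷ []) (pre-head t j)
wprefix-pre t {suc j} {suc m} (s≤s m≤j) = cong (t 0 ∷⁺_) (wprefix-pre (shift t 1) m≤j)

prefixS-suc : ∀ {A : Set} (t : Stream A) (j : ℕ) →
              prefixS t (suc j) ≡ t 0 ∷ prefixS (shift t 1) j
prefixS-suc t j = cong (t 0 ∷_) (begin
  map t (applyUpTo suc j)       ≡⟨ cong (map t) (sym (map-upTo suc j)) ⟩
  map t (map suc (upTo j))      ≡⟨ sym (map-∘ (upTo j)) ⟩
  map (t ∘ suc) (upTo j)        ≡⟨ map-cong (λ i → cong t (+-comm 1 i)) (upTo j) ⟩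
  map (shift t 1) (upTo j)      ∎)
  where
  open ≡-Reasoning

toList-pre : ∀ {A : Set} (t : Stream A) (j : ℕ) → toList (pre t j) ≡ prefixS t (suc j)
toList-pre t zero    = refl
toList-pre t (suc j) =
  trans (cong (t 0 ∷_) (toList-pre (shift t 1) j)) (sym (prefixS-suc t (suc j)))

pre≡⇔prefixS≡ : ∀ {A : Set} (s t : Stream A) (j : ℕ) →
                (pre s j ≡ pre t j) ⇔ (prefixS s (suc j) ≡ prefixS t (suc j))
pre≡⇔prefixS≡ s t j = mk⇔
  (λ e → trans (sym (toList-pre s j)) (trans (cong toList e) (toList-pre t j)))
  (λ e → toList-injective (trans (toList-pre s j) (trans e (sym (toList-pre t j)))))
  where
  toList-injective : ∀ {u v : List⁺ _} → toList u ≡ toList v → u ≡ v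
  toList-injective {_ ∷ _} {_ ∷ _} e = cong₂ _∷_ (∷-injectiveˡ e) (∷-injectiveʳ e)

-- Equal words of the form pre have equal lengths, hence the same index.
pre≡⇒prefixS≡ : ∀ {A : Set} (s t : Stream A) {i j : ℕ} →
                pre s i ≡ pre t j → prefixS s (suc j) ≡ prefixS t (suc j)
pre≡⇒prefixS≡ s t {i} {j} e
  with trans (sym (pre-length s i)) (trans (cong (length ∘ tail) e) (pre-length t j))
... | refl = to (pre≡⇔prefixS≡ s t j) e

Avoids : ∀ {A : Set} → Pred (List⁺ A) 0ℓ → Pred (Stream A) 0ℓ
Avoids P s = ∀ j → ¬ P (pre s j)

module _ (lem : ExcludedMiddle 0ℓ) (A : Set) where

  Ω-halts⇒prefix∈ : ∀ (t : Stream A) (P : PFSet A) k →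
                    run (Ω lem A) t P k ≡ ⇓ → ∃[ j ] proj₁ P (pre t j)
  Ω-halts⇒prefix∈ t (P , pf) zero halt with lem {P (t 0 ∷ [])}
  ... | yes t0∈P = 0 , t0∈P
  ... | no _     with () ← halt
  Ω-halts⇒prefix∈ t (P , pf) (suc k) halt with lem {P (t 0 ∷ [])}
  ... | yes t0∈P = 0 , t0∈P
  ... | no _ =
    let (j , pre∈) = Ω-halts⇒prefix∈ (shift t 1) (deriv (t 0) P , deriv-pf (t 0) P pf) k halt
    in suc j , pre∈

  prefix∈⇒Ω-halts : ∀ (t : Stream A) (P : PFSet A) j →
                    proj₁ P (pre t j) → run (Ω lem A) t P j ≡ ⇓
  prefix∈⇒Ω-halts t (P , pf) zero pre∈ with lem {P (t 0 ∷ [])}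
  ... | yes _   = refl
  ... | no t0∉P = ⊥-elim (t0∉P pre∈)
  prefix∈⇒Ω-halts t (P , pf) (suc j) pre∈ with lem {P (t 0 ∷ [])}
  ... | yes _ = refl
  ... | no _  = prefix∈⇒Ω-halts (shift t 1) (deriv (t 0) P , deriv-pf (t 0) P pf) j pre∈

  𝒞Ω≐Avoids : (P : PFSet A) → 𝒞 (Ω lem A) P ≐ Avoids (proj₁ P)
  𝒞Ω≐Avoids P =
    (λ {s} c j pre∈ → to (𝒞-run (Ω lem A) P s) c j (prefix∈⇒Ω-halts s P j pre∈)) ,
    (λ {s} avoids → from (𝒞-run (Ω lem A) P s) λ k halt →
       let (j , pre∈) = Ω-halts⇒prefix∈ s P k halt in avoids j pre∈)

IsSafety-≐ : ∀ {A : Set} {S T : Pred (Stream A) 0ℓ} → S ≐ T → IsSafety S → IsSafety T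
IsSafety-≐ (S⊆T , T⊆S) safe s approx =
  S⊆T (safe s λ m → let (s' , s'∈T , agree) = approx m in s' , T⊆S s'∈T , agree)

-- Any set of forbidden prefixes defines a safety constraint: a stream all
-- of whose prefixes are prefixes of P-avoiding streams cannot meet P.
Avoids-safety : ∀ {A : Set} (P : Pred (List⁺ A) 0ℓ) → IsSafety (Avoids P)
Avoids-safety P s approx j pre∈ =
  let (s' , avoids' , agree) = approx (suc j)
  in avoids' j (subst P (sym (from (pre≡⇔prefixS≡ s' s j) agree)) pre∈)

module MinimalBadPrefixes (lem : ExcludedMiddle 0ℓ) {A : Set} (S : Pred (Stream A) 0ℓ) where

  Good : List⁺ A → Set
  Good u = ∃[ s' ] (S s' × ∃[ j ] pre s' j ≡ u)

  MinimalBad : List⁺ A → Set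
  MinimalBad u = ¬ Good u × (∀ m → m < length (tail u) → Good (wprefix u m))

  MinimalBad-prefixFree : PrefixFree MinimalBad
  MinimalBad-prefixFree u (_ , proper-good) m m< (bad , _) = bad (proper-good m m<)

  -- Strong induction on j: all shorter prefixes being good, t[0:j+1] is
  -- good, since otherwise (excluded middle) it would be minimal bad.
  avoids⇒good : ∀ t → Avoids MinimalBad t → ∀ j → Good (pre t j)
  avoids⇒good t avoids = <-rec (λ j → Good (pre t j)) step
    where
    step : ∀ j → (∀ {m} → m < j → Good (pre t m)) → Good (pre t j)
    step j shorter-good with lem {Good (pre t j)}
    ... | yes good = good
    ... | no bad = ⊥-elim (avoids j (bad , proper-good))
      where
      proper-good : ∀ m → m < length (tail (pre t j)) → Good (wprefix (pre t j) m)
      proper-good m m< =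
        let m<j = subst (m <_) (pre-length t j) m<
        in subst Good (sym (wprefix-pre t (<⇒≤ m<j))) (shorter-good m<j)

  safety≐Avoids : IsSafety S → S ≐ Avoids MinimalBad
  safety≐Avoids safe =
    (λ {s} s∈S j (bad , _) → bad (s , s∈S , j , refl)) ,
    (λ {s} avoids → safe s (approximants s avoids))
    where
    approximants : ∀ s → Avoids MinimalBad s →
                   (m : ℕ) → ∃[ s' ] (S s' × prefixS s' m ≡ prefixS s m)
    approximants s avoids zero =
      let (s' , s'∈S , _) = avoids⇒good s avoids 0 in s' , s'∈S , refl
    approximants s avoids (suc j) =
      let (s' , s'∈S , _ , e) = avoids⇒good s avoids j
      in s' , s'∈S , pre≡⇒prefixS≡ s' s e

theorem4 : (lem : ExcludedMiddle 0ℓ) (Σ : Set) (k : ℕ) → Σ ↔ Fin k →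
    (S : Pred (Stream Σ) 0ℓ) →
    IsSafety S ⇔ (∃[ P ] (S ≐ 𝒞 (Ω lem Σ) P))
theorem4 lem A _ _ S = mk⇔ safety⇒Ω Ω⇒safety
  where
  open MinimalBadPrefixes lem S

  safety⇒Ω : IsSafety S → ∃[ P ] (S ≐ 𝒞 (Ω lem A) P)
  safety⇒Ω safe =
    let P = MinimalBad , MinimalBad-prefixFree
    in P , ≐-trans (safety≐Avoids safe) (≐-sym (𝒞Ω≐Avoids lem A P))

  Ω⇒safety : ∃[ P ] (S ≐ 𝒞 (Ω lem A) P) → IsSafety S
  Ω⇒safety (P , S≐𝒞) =
    IsSafety-≐ (≐-sym (≐-trans S≐𝒞 (𝒞Ω≐Avoids lem A P))) (Avoids-safety (proj₁ P))
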